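{- Let $K$ be a field and $X$ a finite set. Then: (1) the monoid $K\mathbb{M}_X=\{\alpha w:\alpha\in K, w\in\mathbb{M}_X\}$ is definable in $\mathbb{A}_K(X)$ with the elements of $X$ as parameters, uniformly in $K$ and $|X|$; (2) the free monoid $\mathbb{M}_X$ is interpretable in $\mathbb{A}_K(X)$ with the elements of $X$ as parameters, uniformly in $K$ and $|X|$.
   Context: $\mathbb{A}_K(X)$ is the free associative unitary algebra over $K$ with free basis $X$, in the language $\{+,\cdot,0,1\}$. $\mathbb{M}_X$ denotes the free monoid on $X$, identified with the set of monomials (words in $X$, including the empty word $1$) of $\mathbb{A}_K(X)$. Uniformly in $K$ and $|X|$ means that the defining/interpreting formulas (with the elements of $X$ substituted for the parameter variables) are the same for all fields $K$ and all sets $X$ of the given cardinality. -}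

module Defs where

open import Level using (Level; _⊔_; 0ℓ; Setω) renaming (suc to lsuc)
open import Algebra.Bundles using (CommutativeRing)
open import Data.Nat using (ℕ; zero; suc)
import Data.Nat as ℕ
open import Data.Fin using (Fin)
import Data.Fin as Fin
open import Data.Vec using (Vec; lookup; tabulate; _∷_; [])
import Data.Vec as V
open import Data.List using (List; foldr; map; concatMap; [_])
import Data.List as List
import Data.List.Properties as ListP
open import Data.Product using (Σ; _×_; _,_; ∃; ∃-syntax)
open import Data.Sum using (_⊎_)
open import Relation.Nullary using (¬_; yes; no)
open import Relation.Binary.PropositionalEquality using (_≡_)
open import Function.Bundles using (_⇔_)

record Field (c ℓ : Level) : Set (lsuc (c ⊔ ℓ)) where
  field
    commutativeRing : CommutativeRing c ℓ
  open CommutativeRing commutativeRing public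
  field
    0≉1     : ¬ (0# ≈ 1#)
    inverse : ∀ x → ¬ (x ≈ 0#) → ∃[ y ] (x * y ≈ 1#)

record Structure (c ℓ : Level) : Set (lsuc (c ⊔ ℓ)) where
  field
    Carrier : Set c
    _≈_     : Carrier → Carrier → Set ℓ
    _+_     : Carrier → Carrier → Carrier
    _*_     : Carrier → Carrier → Carrier
    0#      : Carrier
    1#      : Carrier

-- First-order terms and formulas of the language {+, ·, 0, 1},
-- with de Bruijn variables: a Formula m has free variables among Fin m.

data Term (m : ℕ) : Set where
  var       : Fin m → Term m
  _⊕_ _⊗_   : Term m → Term m → Term m
  𝟘 𝟙       : Term m

data Formula (m : ℕ) : Set where
  _≐_       : Term m → Term m → Formula m
  ⊤f ⊥f     : Formula m
  ¬f_       : Formula m → Formula m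
  _∧f_ _∨f_ _⇒f_ : Formula m → Formula m → Formula m
  ∃f ∀f     : Formula (suc m) → Formula m

module _ {c ℓ} (S : Structure c ℓ) where
  open Structure S

  ⟦_⟧t : ∀ {m} → Term m → Vec Carrier m → Carrier
  ⟦ var i ⟧t ρ = lookup ρ i
  ⟦ s ⊕ t ⟧t ρ = ⟦ s ⟧t ρ + ⟦ t ⟧t ρ
  ⟦ s ⊗ t ⟧t ρ = ⟦ s ⟧t ρ * ⟦ t ⟧t ρ
  ⟦ 𝟘 ⟧t ρ = 0#
  ⟦ 𝟙 ⟧t ρ = 1#

  Sat : ∀ {m} → Formula m → Vec Carrier m → Set (c ⊔ ℓ)
  Sat (s ≐ t) ρ = Level.Lift (c ⊔ ℓ) (⟦ s ⟧t ρ ≈ ⟦ t ⟧t ρ)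
  Sat ⊤f ρ = Level.Lift (c ⊔ ℓ) Data.Unit.⊤ where import Data.Unit
  Sat ⊥f ρ = Level.Lift (c ⊔ ℓ) Data.Empty.⊥ where import Data.Empty
  Sat (¬f φ) ρ = ¬ Sat φ ρ
  Sat (φ ∧f ψ) ρ = Sat φ ρ × Sat ψ ρ
  Sat (φ ∨f ψ) ρ = Sat φ ρ ⊎ Sat ψ ρ
  Sat (φ ⇒f ψ) ρ = Sat φ ρ → Sat ψ ρ
  Sat (∃f φ) ρ = Σ Carrier λ a → Sat φ (a ∷ ρ)
  Sat (∀f φ) ρ = (a : Carrier) → Sat φ (a ∷ ρ)

-- The free monoid M_X on X = Fin n: words = lists over Fin n,
-- multiplication = concatenation, unit = empty word.

Word : ℕ → Set
Word n = List (Fin n)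

-- An element is represented by a finite formal sum  Σ αᵢ wᵢ  (a list of
-- coefficient/monomial pairs); two representations are equal iff they
-- have the same coefficient at every monomial.

module FreeAlgebra {c ℓ} (K : Field c ℓ) (n : ℕ) where
  private module K = Field K

  Poly : Set c
  Poly = List (K.Carrier × Word n)

  coeff : Poly → Word n → K.Carrier
  coeff List.[] w = K.0#
  coeff ((α , v) List.∷ p) w with ListP.≡-dec Fin._≟_ v w
  ... | yes _ = α K.+ coeff p w
  ... | no  _ = coeff p w

  _≈ₚ_ : Poly → Poly → Set ℓ
  p ≈ₚ q = ∀ w → coeff p w K.≈ coeff q w

  _+ₚ_ : Poly → Poly → Poly
  p +ₚ q = p List.++ q

  _*ₚ_ : Poly → Poly → Poly
  p *ₚ q = concatMap (λ { (α , v) → map (λ { (β , u) → (α K.* β , v List.++ u) }) q }) p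

  0ₚ 1ₚ : Poly
  0ₚ = List.[]
  1ₚ = [ (K.1# , List.[]) ]

  mono : K.Carrier → Word n → Poly
  mono α w = [ (α , w) ]

  gens : Vec Poly n
  gens = tabulate (λ i → mono K.1# [ i ])

  𝔸 : Structure c ℓ
  𝔸 = record { Carrier = Poly ; _≈_ = _≈ₚ_ ; _+_ = _+ₚ_ ; _*_ = _*ₚ_
             ; 0# = 0ₚ ; 1# = 1ₚ }

  InKM : Poly → Set (c ⊔ ℓ)
  InKM a = Σ K.Carrier λ α → Σ (Word n) λ w → a ≈ₚ mono α w

  SatA : ∀ {m} → Formula m → Vec Poly m → Set (c ⊔ ℓ)
  SatA = Sat 𝔸

-- (1) Uniform definability of K M_X with parameters X:
-- a formula φ(x; x₁,…,xₙ) (variable 0 = x, variables 1..n = parameters),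
-- depending only on n, such that in every A_K(X) with |X| = n,
-- A_K(X) ⊨ φ(a; X)  iff  a ∈ K M_X.

DefinesKM : ∀ {c ℓ} (K : Field c ℓ) (n : ℕ) → Formula (suc n) → Set (c ⊔ ℓ)
DefinesKM K n φ = ∀ a → SatA φ (a ∷ gens) ⇔ InKM a
  where open FreeAlgebra K n

-- (2) Interpretations (with parameters X) of the monoid language {·, 1}
-- in A_K(X), of dimension k: a domain formula δ(ā), an equivalence
-- formula ε(ā, b̄), a formula μ(ā, b̄, c̄) for the graph of the
-- multiplication and a formula ι(ā) for the unit, each additionally
-- having the n parameters x₁,…,xₙ as the last free variables.

record MonoidInterpretation (n k : ℕ) : Set where
  field
    δ : Formula (k ℕ.+ n)
    ε : Formula (k ℕ.+ (k ℕ.+ n))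
    μ : Formula (k ℕ.+ (k ℕ.+ (k ℕ.+ n)))
    ι : Formula (k ℕ.+ n)

module _ {c ℓ} (K : Field c ℓ) (n k : ℕ) (I : MonoidInterpretation n k) where
  open FreeAlgebra K n
  open MonoidInterpretation I
  open V using (_++_)

  private
    D : Vec Poly k → Set (c ⊔ ℓ)
    D a = SatA δ (a ++ gens)
    E : Vec Poly k → Vec Poly k → Set (c ⊔ ℓ)
    E a b = SatA ε (a ++ (b ++ gens))
    Mu : Vec Poly k → Vec Poly k → Vec Poly k → Set (c ⊔ ℓ)
    Mu a b d = SatA μ (a ++ (b ++ (d ++ gens)))
    Iota : Vec Poly k → Set (c ⊔ ℓ)
    Iota a = SatA ι (a ++ gens)

  record InterpretsFreeMonoid : Set (c ⊔ ℓ) where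
    field
      ε-refl  : ∀ a → D a → E a a
      ε-sym   : ∀ a b → D a → D b → E a b → E b a
      ε-trans : ∀ a b d → D a → D b → D d → E a b → E b d → E a d
      f        : Word n → Vec Poly k
      f-dom    : ∀ w → D (f w)
      f-inj    : ∀ w v → E (f w) (f v) → w ≡ v
      f-surj   : ∀ a → D a → Σ (Word n) λ w → E a (f w)
      μ-spec   : ∀ a b d → D a → D b → D d →
                 Mu a b d ⇔ (Σ (Word n) λ w → Σ (Word n) λ v →
                             E a (f w) × E b (f v) × E d (f (w List.++ v)))
      ι-spec   : ∀ a → D a → Iota a ⇔ E a (f List.[])

-- Setω-valued dependent pair (needed because uniformity quantifies over
-- fields of all universe levels after the formulas are chosen).

record Σω (A : Set) (P : A → Setω) : Setω where
  constructor _,ω_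
  field
    witness  : A
    property : P witness

record _×ω_ (A B : Setω) : Setω where
  constructor _,,_
  field
    fst : A
    snd : B

-- The coefficient of a word in a product is a convolution of coefficients, so if u r = α w with
-- α ≠ 0, comparing the longest and the shortest words of the supports of u and r shows that u and r
-- are themselves nonzero terms β v and γ t with v t = w. Hence every right factor of a term is 0,
-- a unit (a nonzero scalar) or a left multiple x i d of a generator. Conversely, if every right
-- factor of a is of this kind, then so is a itself (a = 1 · a); if a = x i d, then every right
-- factor of d is a right factor of a, and induction on the degree shows a ∈ K M_X. The free monoid
-- is interpreted on the nonzero terms, two of which are associates exactly when they carry the
-- same word.

module Submission where

open import Defs
open import Level using (_⊔_; Lift; lift; lower)
open import Data.Nat using (ℕ; zero; suc; _≤_; _<_)
import Data.Nat as ℕ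
import Data.Nat.Properties as ℕP
open import Data.Fin using (Fin; #_; _↑ʳ_)
import Data.Fin as Fin
open import Data.List using (List; []; _∷_; _++_; [_]; map; length; filter)
import Data.List.Properties as ListP
open import Data.List.Membership.Propositional using (_∈_)
open import Data.List.Membership.Propositional.Properties using (∈-filter⁺)
open import Data.List.Relation.Unary.Any using (here; there)
import Data.List.Relation.Unary.All as All
open import Data.List.Relation.Unary.All.Properties using (all-filter)
open import Data.Vec using (lookup) renaming (_∷_ to _∷ᵥ_; [] to []ᵥ)
open import Data.Vec.Properties using (lookup∘tabulate)
open import Data.Product using (Σ; _×_; _,_; proj₁; proj₂; uncurry)
open import Data.Sum using (_⊎_; inj₁; inj₂)
import Data.Sum as Sum
open import Data.Empty using (⊥-elim)
open import Function using (_∘_)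
open import Function.Bundles using (_⇔_; mk⇔; Equivalence)
open import Function.Construct.Composition using (_⇔-∘_)
open import Function.Construct.Symmetry using (⇔-sym)
open import Relation.Nullary using (¬_; yes; no; Dec; ¬?)
open import Relation.Nullary.Decidable using (map′; decidable-stable)
open import Relation.Binary.Bundles using (Setoid)
import Relation.Binary.Reasoning.Setoid
open import Relation.Binary.PropositionalEquality as ≡ using (_≡_; _≢_; refl)
open import Relation.Binary.Definitions using (tri<; tri≈; tri>)
open import Axiom.ExcludedMiddle using (ExcludedMiddle)

≤-+-≡⇒≡ˡ : ∀ {a b c d} → a ≤ b → c ≤ d → a ℕ.+ c ≡ b ℕ.+ d → a ≡ b
≤-+-≡⇒≡ˡ {a} {b} {c} {d} a≤b c≤d a+c≡b+d = ℕP.≤-antisym a≤b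
  (ℕP.+-cancelʳ-≤ d b a (ℕP.≤-trans (ℕP.≤-reflexive (≡.sym a+c≡b+d)) (ℕP.+-monoʳ-≤ a c≤d)))

length-++-≡ : ∀ {A : Set} (v t v′ t′ : List A) →
              v′ ++ t′ ≡ v ++ t → length v′ ℕ.+ length t′ ≡ length v ℕ.+ length t
length-++-≡ v t v′ t′ v′t′≡vt =
  ≡.trans (≡.sym (ListP.length-++ v′)) (≡.trans (≡.cong length v′t′≡vt) (ListP.length-++ v))

length-split-< : ∀ {A : Set} (v t v′ t′ : List A) →
                 v′ ++ t′ ≡ v ++ t → length v′ < length v → length t < length t′
length-split-< v t v′ t′ v′t′≡vt |v′|<|v| =
  ℕP.≰⇒> λ |t′|≤|t| → ℕP.<-irrefl (length-++-≡ v t v′ t′ v′t′≡vt) (ℕP.+-mono-<-≤ |v′|<|v| |t′|≤|t|)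

⋁ : ∀ {k m} → (Fin k → Formula m) → Formula m
⋁ {zero}  ψ = ⊥f
⋁ {suc k} ψ = ψ Fin.zero ∨f ⋁ (ψ ∘ Fin.suc)

isUnit : ∀ {m} → Fin m → Formula m
isUnit j = ∃f ((var (Fin.suc j) ⊗ var Fin.zero) ≐ 𝟙)

isZeroOrUnit : ∀ {m} → Fin m → Formula m
isZeroOrUnit j = (var j ≐ 𝟘) ∨f isUnit j

-- x i is the position of the i-th generator among the variables.
inGeneratorIdeal : ∀ {n m} → (Fin n → Fin m) → Fin m → Formula m
inGeneratorIdeal x j = ⋁ λ i → ∃f (var (Fin.suc j) ≐ (var (Fin.suc (x i)) ⊗ var Fin.zero))

module _ {c ℓ} (S : Structure c ℓ) where
  open Structure S

  Sat-⋁⁺ : ∀ {k m} (ψ : Fin k → Formula m) {ρ} i → Sat S (ψ i) ρ → Sat S (⋁ ψ) ρ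
  Sat-⋁⁺ ψ Fin.zero    s = inj₁ s
  Sat-⋁⁺ ψ (Fin.suc i) s = inj₂ (Sat-⋁⁺ (ψ ∘ Fin.suc) i s)

  Sat-⋁⁻ : ∀ {k m} (ψ : Fin k → Formula m) {ρ} → Sat S (⋁ ψ) ρ → Σ (Fin k) λ i → Sat S (ψ i) ρ
  Sat-⋁⁻ {zero}  ψ (lift ())
  Sat-⋁⁻ {suc k} ψ (inj₁ s) = Fin.zero , s
  Sat-⋁⁻ {suc k} ψ (inj₂ s) with Sat-⋁⁻ (ψ ∘ Fin.suc) s
  ... | i , sᵢ = Fin.suc i , sᵢ

  Sat-inGeneratorIdeal : ∀ {n m} (x : Fin n → Fin m) j {ρ} →
    Sat S (inGeneratorIdeal x j) ρ ⇔
    Σ (Fin n) λ i → Σ Carrier λ d → Lift (c ⊔ ℓ) (lookup ρ j ≈ (lookup ρ (x i) * d))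
  Sat-inGeneratorIdeal {n} {m} x j = mk⇔ (Sat-⋁⁻ ψ) (uncurry (Sat-⋁⁺ ψ))
    where
    ψ : Fin n → Formula m
    ψ i = ∃f (var (Fin.suc j) ≐ (var (Fin.suc (x i)) ⊗ var Fin.zero))

-- Under the two quantifiers the environment is  r ∷ u ∷ a ∷ x₀ ∷ … , so the body reads
-- a = u r ⇒ r = 0 ∨ r is a unit ∨ r ∈ x i A for some i.
KM-formula : (n : ℕ) → Formula (suc n)
KM-formula n =
  (var (# 0) ≐ 𝟘) ∨f
  ∀f (∀f ((var (# 2) ≐ (var (# 1) ⊗ var (# 0))) ⇒f (isZeroOrUnit (# 0) ∨f inGeneratorIdeal (3 ↑ʳ_) (# 0))))

-- A word w is represented by the nonzero multiples α w, up to multiplication by a unit.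
freeMonoidInterpretation : (n : ℕ) → MonoidInterpretation n 1
freeMonoidInterpretation n = record
  { δ = KM-formula n ∧f (¬f (var (# 0) ≐ 𝟘))
  ; ε = ∃f (isUnit (# 0) ∧f (var (# 1) ≐ (var (# 0) ⊗ var (# 2))))
  ; μ = ∃f (isUnit (# 0) ∧f (var (# 3) ≐ (var (# 0) ⊗ (var (# 1) ⊗ var (# 2)))))
  ; ι = isUnit (# 0)
  }

module FieldProperties {c ℓ} (K : Field c ℓ) where
  open Field K renaming (Carrier to F; refl to ≈-refl; sym to ≈-sym; trans to ≈-trans)
  open import Relation.Binary.Reasoning.Setoid setoid

  1≉0 : ¬ 1# ≈ 0#
  1≉0 = 0≉1 ∘ ≈-sym

  *-nonzero : ∀ {x y} → ¬ x ≈ 0# → ¬ y ≈ 0# → ¬ x * y ≈ 0#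
  *-nonzero {x} {y} x≉0 y≉0 xy≈0 with inverse x x≉0
  ... | x⁻¹ , xx⁻¹≈1 = y≉0 (begin
    y                ≈⟨ *-identityˡ y ⟨
    1# * y           ≈⟨ *-cong (≈-trans (≈-sym xx⁻¹≈1) (*-comm x x⁻¹)) ≈-refl ⟩
    (x⁻¹ * x) * y    ≈⟨ *-assoc x⁻¹ x y ⟩
    x⁻¹ * (x * y)    ≈⟨ *-cong ≈-refl xy≈0 ⟩
    x⁻¹ * 0#         ≈⟨ zeroʳ x⁻¹ ⟩
    0#               ∎)

  quotient : ∀ {α β} → ¬ α ≈ 0# → ¬ β ≈ 0# → Σ F λ γ → ¬ γ ≈ 0# × γ * β ≈ α
  quotient {α} {β} α≉0 β≉0 with inverse β β≉0
  ... | β⁻¹ , ββ⁻¹≈1 = α * β⁻¹ , *-nonzero α≉0 β⁻¹≉0 , (begin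
    (α * β⁻¹) * β    ≈⟨ *-assoc α β⁻¹ β ⟩
    α * (β⁻¹ * β)    ≈⟨ *-cong ≈-refl (≈-trans (*-comm β⁻¹ β) ββ⁻¹≈1) ⟩
    α * 1#           ≈⟨ *-identityʳ α ⟩
    α                ∎)
    where
    β⁻¹≉0 : ¬ β⁻¹ ≈ 0#
    β⁻¹≉0 β⁻¹≈0 = 1≉0 (≈-trans (≈-sym ββ⁻¹≈1) (≈-trans (*-cong ≈-refl β⁻¹≈0) (zeroʳ β)))

module FreeAlgebraProperties {c ℓ} (K : Field c ℓ) (n : ℕ) where
  open FreeAlgebra K n
  open FieldProperties K
  open Field K renaming (Carrier to F; refl to ≈-refl; sym to ≈-sym; trans to ≈-trans)
  module ≈-Reasoning = Relation.Binary.Reasoning.Setoid setoid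
  open import Algebra.Properties.CommutativeSemigroup +-commutativeSemigroup
    using () renaming (interchange to +-interchange)

  _≟ʷ_ : (v w : Word n) → Dec (v ≡ w)
  _≟ʷ_ = ListP.≡-dec Fin._≟_

  ≈ₚ-setoid : Setoid c ℓ
  ≈ₚ-setoid = record
    { Carrier       = Poly
    ; _≈_           = _≈ₚ_
    ; isEquivalence = record
      { refl  = λ _ → ≈-refl
      ; sym   = λ p≈q w → ≈-sym (p≈q w)
      ; trans = λ p≈q q≈r w → ≈-trans (p≈q w) (q≈r w)
      }
    }

  module ≈ₚ = Setoid ≈ₚ-setoid
  module ≈ₚ-Reasoning = Relation.Binary.Reasoning.Setoid ≈ₚ-setoid

  coeff-∷-≡ : ∀ {α v p w} → v ≡ w → coeff ((α , v) ∷ p) w ≈ α + coeff p w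
  coeff-∷-≡ {v = v} {w = w} v≡w with v ≟ʷ w
  ... | yes _   = ≈-refl
  ... | no v≢w = ⊥-elim (v≢w v≡w)

  coeff-∷-≢ : ∀ {α v p w} → v ≢ w → coeff ((α , v) ∷ p) w ≈ coeff p w
  coeff-∷-≢ {v = v} {w = w} v≢w with v ≟ʷ w
  ... | yes v≡w = ⊥-elim (v≢w v≡w)
  ... | no _    = ≈-refl

  coeff-mono-≡ : ∀ α v → coeff (mono α v) v ≈ α
  coeff-mono-≡ α v = ≈-trans (coeff-∷-≡ {v = v} {p = []} refl) (+-identityʳ α)

  coeff-mono-≢ : ∀ {α v w} → v ≢ w → coeff (mono α v) w ≈ 0#
  coeff-mono-≢ = coeff-∷-≢

  ∷-cong : ∀ {α β} v p q → α ≈ β → p ≈ₚ q → ((α , v) ∷ p) ≈ₚ ((β , v) ∷ q)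
  ∷-cong v p q α≈β p≈q w with v ≟ʷ w
  ... | yes _ = +-cong α≈β (p≈q w)
  ... | no _  = p≈q w

  mono-cong : ∀ {α β} v → α ≈ β → mono α v ≈ₚ mono β v
  mono-cong v α≈β = ∷-cong v [] [] α≈β (≈ₚ.refl {[]})

  mono-≈0 : ∀ {α} v → α ≈ 0# → mono α v ≈ₚ 0ₚ
  mono-≈0 v α≈0 w with v ≟ʷ w
  ... | yes _ = ≈-trans (+-identityʳ _) α≈0
  ... | no _  = ≈-refl

  mono-word-injective : ∀ {α β v w} → mono α v ≈ₚ mono β w → ¬ α ≈ 0# → v ≡ w
  mono-word-injective {α} {β} {v} {w} αv≈βw α≉0 with w ≟ʷ v
  ... | yes w≡v = ≡.sym w≡v
  ... | no w≢v  = ⊥-elim (α≉0 (begin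
    α                   ≈⟨ coeff-mono-≡ α v ⟨
    coeff (mono α v) v  ≈⟨ αv≈βw v ⟩
    coeff (mono β w) v  ≈⟨ coeff-mono-≢ w≢v ⟩
    0#                  ∎))
    where open ≈-Reasoning

  coeff-++ : ∀ p q w → coeff (p ++ q) w ≈ coeff p w + coeff q w
  coeff-++ []            q w = ≈-sym (+-identityˡ _)
  coeff-++ ((α , v) ∷ p) q w with v ≟ʷ w
  ... | yes _ = ≈-trans (+-cong ≈-refl (coeff-++ p q w)) (≈-sym (+-assoc _ _ _))
  ... | no _  = coeff-++ p q w

  +ₚ-cong : ∀ p p′ q q′ → p ≈ₚ p′ → q ≈ₚ q′ → (p +ₚ q) ≈ₚ (p′ +ₚ q′)
  +ₚ-cong p p′ q q′ p≈p′ q≈q′ w = begin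
    coeff (p ++ q) w          ≈⟨ coeff-++ p q w ⟩
    coeff p w + coeff q w     ≈⟨ +-cong (p≈p′ w) (q≈q′ w) ⟩
    coeff p′ w + coeff q′ w   ≈⟨ coeff-++ p′ q′ w ⟨
    coeff (p′ ++ q′) w        ∎
    where open ≈-Reasoning

  prefix? : (v w : Word n) → (Σ (Word n) λ t → w ≡ v ++ t) ⊎ (∀ t → w ≢ v ++ t)
  prefix? []      w       = inj₁ (w , refl)
  prefix? (y ∷ v) []      = inj₂ λ _ ()
  prefix? (y ∷ v) (x ∷ w) with x Fin.≟ y | prefix? v w
  ... | no x≢y   | _              = inj₂ λ { _ refl → x≢y refl }
  ... | yes refl | inj₁ (t , w≡vt) = inj₁ (t , ≡.cong (y ∷_) w≡vt)
  ... | yes refl | inj₂ w≢vt      = inj₂ λ t → w≢vt t ∘ ListP.∷-injectiveʳ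

  termMul : F → Word n → Poly → Poly
  termMul α v = map λ { (β , u) → (α * β , v ++ u) }

  coeff-termMul-++ : ∀ α v q t → coeff (termMul α v q) (v ++ t) ≈ α * coeff q t
  coeff-termMul-++ α v []            t = ≈-sym (zeroʳ α)
  coeff-termMul-++ α v ((β , u) ∷ q) t with u ≟ʷ t
  ... | yes refl = begin
    coeff (termMul α v ((β , u) ∷ q)) (v ++ u)  ≈⟨ coeff-∷-≡ {p = termMul α v q} refl ⟩
    α * β + coeff (termMul α v q) (v ++ u)      ≈⟨ +-cong ≈-refl (coeff-termMul-++ α v q u) ⟩
    α * β + α * coeff q u                       ≈⟨ distribˡ α β _ ⟨
    α * (β + coeff q u)                         ∎
    where open ≈-Reasoning
  ... | no u≢t =
    ≈-trans (coeff-∷-≢ {p = termMul α v q} (u≢t ∘ ListP.++-cancelˡ v u t)) (coeff-termMul-++ α v q t)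

  coeff-termMul-∉ : ∀ α v q {w} → (∀ t → w ≢ v ++ t) → coeff (termMul α v q) w ≈ 0#
  coeff-termMul-∉ α v []            w∉ = ≈-refl
  coeff-termMul-∉ α v ((β , u) ∷ q) w∉ =
    ≈-trans (coeff-∷-≢ {p = termMul α v q} (w∉ u ∘ ≡.sym)) (coeff-termMul-∉ α v q w∉)

  coeff-mono-*ₚ : ∀ α v q t → coeff (mono α v *ₚ q) (v ++ t) ≈ α * coeff q t
  coeff-mono-*ₚ α v q t = begin
    coeff (termMul α v q ++ []) (v ++ t)   ≡⟨ ≡.cong (λ p → coeff p (v ++ t)) (ListP.++-identityʳ (termMul α v q)) ⟩
    coeff (termMul α v q) (v ++ t)         ≈⟨ coeff-termMul-++ α v q t ⟩
    α * coeff q t                          ∎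
    where open ≈-Reasoning

  -- (f ⋆ g) w is the sum of f v * g t over all splittings w = v ++ t, found by moving the
  -- letters of w one at a time from t to v.
  infixl 7 _⋆_
  _⋆_ : (Word n → F) → (Word n → F) → Word n → F
  (f ⋆ g) []      = f [] * g []
  (f ⋆ g) (x ∷ w) = f [] * g (x ∷ w) + ((f ∘ (x ∷_)) ⋆ g) w

  ⋆-cong : ∀ {f f′ g g′} → (∀ s → f s ≈ f′ s) → (∀ s → g s ≈ g′ s) →
           ∀ w → (f ⋆ g) w ≈ (f′ ⋆ g′) w
  ⋆-cong f≈f′ g≈g′ []      = *-cong (f≈f′ []) (g≈g′ [])
  ⋆-cong f≈f′ g≈g′ (x ∷ w) = +-cong (*-cong (f≈f′ []) (g≈g′ (x ∷ w))) (⋆-cong (f≈f′ ∘ (x ∷_)) g≈g′ w)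

  ⋆-distribʳ-+ : ∀ f h g w → ((λ s → f s + h s) ⋆ g) w ≈ (f ⋆ g) w + (h ⋆ g) w
  ⋆-distribʳ-+ f h g []      = distribʳ _ _ _
  ⋆-distribʳ-+ f h g (x ∷ w) = ≈-trans
    (+-cong (distribʳ _ _ _) (⋆-distribʳ-+ (f ∘ (x ∷_)) (h ∘ (x ∷_)) g w))
    (+-interchange _ _ _ _)

  ⋆-vanishing : ∀ f g w → (∀ v t → v ++ t ≡ w → f v * g t ≈ 0#) → (f ⋆ g) w ≈ 0#
  ⋆-vanishing f g []      fg≈0 = fg≈0 [] [] refl
  ⋆-vanishing f g (x ∷ w) fg≈0 = ≈-trans
    (+-cong (fg≈0 [] (x ∷ w) refl)
            (⋆-vanishing (f ∘ (x ∷_)) g w λ v t vt≡w → fg≈0 (x ∷ v) t (≡.cong (x ∷_) vt≡w)))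
    (+-identityˡ 0#)

  ⋆-single : ∀ f g v t →
             (∀ v′ t′ → v′ ++ t′ ≡ v ++ t → length v′ ≢ length v → f v′ * g t′ ≈ 0#) →
             (f ⋆ g) (v ++ t) ≈ f v * g t
  ⋆-single f g []      []      _      = ≈-refl
  ⋆-single f g []      (x ∷ t) others = ≈-trans
    (+-cong ≈-refl (⋆-vanishing (f ∘ (x ∷_)) g t λ v′ t′ v′t′≡t →
                      others (x ∷ v′) t′ (≡.cong (x ∷_) v′t′≡t) λ ()))
    (+-identityʳ _)
  ⋆-single f g (y ∷ v) t others = ≈-trans
    (+-cong (others [] (y ∷ v ++ t) refl λ ())
            (⋆-single (f ∘ (y ∷_)) g v t λ v′ t′ v′t′≡vt |v′|≢|v| →
              others (y ∷ v′) t′ (≡.cong (y ∷_) v′t′≡vt) (|v′|≢|v| ∘ ℕP.suc-injective)))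
    (+-identityˡ _)

  ⋆-mono-++ : ∀ α v g t → (coeff (mono α v) ⋆ g) (v ++ t) ≈ α * g t
  ⋆-mono-++ α v g t = ≈-trans
    (⋆-single _ g v t λ v′ t′ _ |v′|≢|v| →
      ≈-trans (*-cong (coeff-mono-≢ {α} {v} {v′} λ v≡v′ → |v′|≢|v| (≡.cong length (≡.sym v≡v′))) ≈-refl)
              (zeroˡ _))
    (*-cong (coeff-mono-≡ α v) ≈-refl)

  ⋆-mono-∉ : ∀ α v g {w} → (∀ t → w ≢ v ++ t) → (coeff (mono α v) ⋆ g) w ≈ 0#
  ⋆-mono-∉ α v g {w} w∉ = ⋆-vanishing _ g w λ v′ t v′t≡w →
    ≈-trans (*-cong (coeff-mono-≢ {α} {v} {v′} λ { refl → w∉ t (≡.sym v′t≡w) }) ≈-refl) (zeroˡ _)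

  coeff-termMul : ∀ α v q w → coeff (termMul α v q) w ≈ (coeff (mono α v) ⋆ coeff q) w
  coeff-termMul α v q w with prefix? v w
  ... | inj₁ (t , refl) = ≈-trans (coeff-termMul-++ α v q t) (≈-sym (⋆-mono-++ α v (coeff q) t))
  ... | inj₂ w∉        = ≈-trans (coeff-termMul-∉ α v q w∉) (≈-sym (⋆-mono-∉ α v (coeff q) w∉))

  coeff-*ₚ : ∀ p q w → coeff (p *ₚ q) w ≈ (coeff p ⋆ coeff q) w
  coeff-*ₚ []            q w = ≈-sym (⋆-vanishing _ (coeff q) w λ _ _ _ → zeroˡ _)
  coeff-*ₚ ((α , v) ∷ p) q w = begin
    coeff (termMul α v q ++ p *ₚ q) w                                    ≈⟨ coeff-++ (termMul α v q) (p *ₚ q) w ⟩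
    coeff (termMul α v q) w + coeff (p *ₚ q) w                           ≈⟨ +-cong (coeff-termMul α v q w) (coeff-*ₚ p q w) ⟩
    (coeff (mono α v) ⋆ coeff q) w + (coeff p ⋆ coeff q) w               ≈⟨ ⋆-distribʳ-+ _ _ (coeff q) w ⟨
    ((λ s → coeff (mono α v) s + coeff p s) ⋆ coeff q) w                 ≈⟨ ⋆-cong (λ s → coeff-++ (mono α v) p s) (λ _ → ≈-refl) w ⟨
    (coeff ((α , v) ∷ p) ⋆ coeff q) w                                    ∎
    where open ≈-Reasoning

  *ₚ-cong : ∀ p p′ q q′ → p ≈ₚ p′ → q ≈ₚ q′ → (p *ₚ q) ≈ₚ (p′ *ₚ q′)
  *ₚ-cong p p′ q q′ p≈p′ q≈q′ w = begin
    coeff (p *ₚ q) w           ≈⟨ coeff-*ₚ p q w ⟩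
    (coeff p ⋆ coeff q) w      ≈⟨ ⋆-cong p≈p′ q≈q′ w ⟩
    (coeff p′ ⋆ coeff q′) w    ≈⟨ coeff-*ₚ p′ q′ w ⟨
    coeff (p′ *ₚ q′) w         ∎
    where open ≈-Reasoning

  *ₚ-identityˡ : ∀ p → (1ₚ *ₚ p) ≈ₚ p
  *ₚ-identityˡ p w = ≈-trans (coeff-mono-*ₚ 1# [] p w) (*-identityˡ (coeff p w))

  termMul-termMul : ∀ α β v u r → termMul (α * β) (v ++ u) r ≈ₚ termMul α v (termMul β u r)
  termMul-termMul α β v u []            = ≈ₚ.refl {[]}
  termMul-termMul α β v u ((γ , s) ∷ r) rewrite ListP.++-assoc v u s =
    ∷-cong (v ++ u ++ s) (termMul (α * β) (v ++ u) r) (termMul α v (termMul β u r))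
      (*-assoc α β γ) (termMul-termMul α β v u r)

  termMul-*ₚ : ∀ α v q r → (termMul α v q *ₚ r) ≈ₚ termMul α v (q *ₚ r)
  termMul-*ₚ α v []            r = ≈ₚ.refl {[]}
  termMul-*ₚ α v ((β , u) ∷ q) r = begin
    termMul (α * β) (v ++ u) r ++ (termMul α v q *ₚ r)   ≈⟨ +ₚ-cong (termMul (α * β) (v ++ u) r) (termMul α v (termMul β u r))
                                                                     (termMul α v q *ₚ r) (termMul α v (q *ₚ r))
                                                                     (termMul-termMul α β v u r) (termMul-*ₚ α v q r) ⟩
    termMul α v (termMul β u r) ++ termMul α v (q *ₚ r)   ≡⟨ ListP.map-++ _ (termMul β u r) (q *ₚ r) ⟨
    termMul α v (termMul β u r ++ q *ₚ r)                 ∎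
    where open ≈ₚ-Reasoning

  *ₚ-assoc : ∀ p q r → ((p *ₚ q) *ₚ r) ≈ₚ (p *ₚ (q *ₚ r))
  *ₚ-assoc []            q r = ≈ₚ.refl {[]}
  *ₚ-assoc ((α , v) ∷ p) q r = begin
    (termMul α v q ++ p *ₚ q) *ₚ r           ≡⟨ ListP.concatMap-++ _ (termMul α v q) (p *ₚ q) ⟩
    (termMul α v q *ₚ r) ++ (p *ₚ q) *ₚ r    ≈⟨ +ₚ-cong (termMul α v q *ₚ r) (termMul α v (q *ₚ r)) ((p *ₚ q) *ₚ r) (p *ₚ (q *ₚ r))
                                                   (termMul-*ₚ α v q r) (*ₚ-assoc p q r) ⟩
    termMul α v (q *ₚ r) ++ p *ₚ (q *ₚ r)    ∎
    where open ≈ₚ-Reasoning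

  x : Fin n → Poly
  x = lookup gens

  x≡mono : ∀ i → x i ≡ mono 1# [ i ]
  x≡mono = lookup∘tabulate _

  Bounded : ℕ → Poly → Set ℓ
  Bounded N a = ∀ w → ¬ coeff a w ≈ 0# → length w < N

  bounded : ∀ a → Σ ℕ λ N → Bounded N a
  bounded []            = 0 , λ _ 0≉0 → ⊥-elim (0≉0 ≈-refl)
  bounded ((α , v) ∷ a) with bounded a
  ... | N , a<N = suc (length v) ℕ.⊔ N , bound
    where
    bound : Bounded (suc (length v) ℕ.⊔ N) ((α , v) ∷ a)
    bound w aw≉0 with v ≟ʷ w
    ... | yes refl = ℕP.m≤m⊔n (suc (length v)) N
    ... | no _     = ℕP.≤-trans (a<N w aw≉0) (ℕP.m≤n⊔m (suc (length v)) N)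

  ∈-words : ∀ p {v} → ¬ coeff p v ≈ 0# → v ∈ map proj₂ p
  ∈-words []            pv≉0 = ⊥-elim (pv≉0 ≈-refl)
  ∈-words ((α , u) ∷ p) {v} pv≉0 with u ≟ʷ v
  ... | yes refl = here refl
  ... | no _     = there (∈-words p pv≉0)

  Bounded-resp-≈ₚ : ∀ {N p q} → p ≈ₚ q → Bounded N q → Bounded N p
  Bounded-resp-≈ₚ p≈q q<N w pw≉0 = q<N w (pw≉0 ∘ ≈-trans (p≈q w))

  Bounded-generator-*ₚ : ∀ {N} i d → Bounded (suc N) (x i *ₚ d) → Bounded N d
  Bounded-generator-*ₚ i d xd<N v dv≉0 rewrite x≡mono i = ℕP.≤-pred (xd<N (i ∷ v) λ xdv≈0 →
    dv≉0 (≈-trans (≈-sym (≈-trans (coeff-mono-*ₚ 1# [ i ] d v) (*-identityˡ _))) xdv≈0))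

  infix 4 _∈K×_
  record _∈K×_ (p : Poly) (w : Word n) : Set (c ⊔ ℓ) where
    constructor term
    field
      coefficient    : F
      coefficient≉0  : ¬ coefficient ≈ 0#
      ≈term          : p ≈ₚ mono coefficient w

  mono-∈K× : ∀ {α} w → ¬ α ≈ 0# → mono α w ∈K× w
  mono-∈K× {α} w α≉0 = term α α≉0 (≈ₚ.refl {mono α w})

  ∈K×-resp-≈ₚ : ∀ {p q w} → p ≈ₚ q → q ∈K× w → p ∈K× w
  ∈K×-resp-≈ₚ p≈q (term α α≉0 q≈αw) = term α α≉0 λ w′ → ≈-trans (p≈q w′) (q≈αw w′)

  ∈K×-word-unique : ∀ {p v w} → p ∈K× v → p ∈K× w → v ≡ w
  ∈K×-word-unique (term α α≉0 p≈αv) (term β _ p≈βw) =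
    mono-word-injective (λ w′ → ≈-trans (≈-sym (p≈αv w′)) (p≈βw w′)) α≉0

  ∈K×-nonzero : ∀ {p w} → p ∈K× w → ¬ p ≈ₚ 0ₚ
  ∈K×-nonzero {w = w} (term α α≉0 p≈αw) p≈0 =
    α≉0 (≈-trans (≈-sym (coeff-mono-≡ α w)) (≈-trans (≈-sym (p≈αw w)) (p≈0 w)))

  *ₚ-∈K× : ∀ {p q v w} → p ∈K× v → q ∈K× w → p *ₚ q ∈K× v ++ w
  *ₚ-∈K× {p} {q} {v} {w} (term α α≉0 p≈αv) (term β β≉0 q≈βw) =
    term (α * β) (*-nonzero α≉0 β≉0) (*ₚ-cong p (mono α v) q (mono β w) p≈αv q≈βw)

  IsUnit : Poly → Set (c ⊔ ℓ)
  IsUnit p = Σ Poly λ s → Lift (c ⊔ ℓ) ((p *ₚ s) ≈ₚ 1ₚ)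

  scalar⇒unit : ∀ {p} → p ∈K× [] → IsUnit p
  scalar⇒unit {p} (term γ γ≉0 p≈γ) with quotient 1≉0 γ≉0
  ... | γ⁻¹ , _ , γ⁻¹γ≈1 = mono γ⁻¹ [] , lift (begin
    p *ₚ mono γ⁻¹ []        ≈⟨ *ₚ-cong p (mono γ []) (mono γ⁻¹ []) (mono γ⁻¹ []) p≈γ (≈ₚ.refl {mono γ⁻¹ []}) ⟩
    mono (γ * γ⁻¹) []       ≈⟨ mono-cong [] (≈-trans (*-comm γ γ⁻¹) γ⁻¹γ≈1) ⟩
    1ₚ                      ∎)
    where open ≈ₚ-Reasoning

  Associated : Poly → Poly → Set (c ⊔ ℓ)
  Associated p q = Σ Poly λ t → IsUnit t × Lift (c ⊔ ℓ) (p ≈ₚ (t *ₚ q))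

  sameWord⇒associated : ∀ {p q w} → p ∈K× w → q ∈K× w → Associated p q
  sameWord⇒associated {p} {q} {w} (term α α≉0 p≈αw) (term β β≉0 q≈βw) with quotient α≉0 β≉0
  ... | γ , γ≉0 , γβ≈α = mono γ [] , scalar⇒unit {mono γ []} (mono-∈K× [] γ≉0) , lift (begin
    p                    ≈⟨ p≈αw ⟩
    mono α w             ≈⟨ mono-cong w γβ≈α ⟨
    mono (γ * β) w       ≈⟨ *ₚ-cong (mono γ []) (mono γ []) q (mono β w) (≈ₚ.refl {mono γ []}) q≈βw ⟨
    mono γ [] *ₚ q       ∎)
    where open ≈ₚ-Reasoning

  InGeneratorIdeal : Poly → Set (c ⊔ ℓ)
  InGeneratorIdeal r = Σ (Fin n) λ i → Σ Poly λ d → Lift (c ⊔ ℓ) (r ≈ₚ (x i *ₚ d))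

  Admissible : Poly → Set (c ⊔ ℓ)
  Admissible r = (Lift (c ⊔ ℓ) (r ≈ₚ 0ₚ) ⊎ IsUnit r) ⊎ InGeneratorIdeal r

  RightFactorsAdmissible : Poly → Set (c ⊔ ℓ)
  RightFactorsAdmissible a = ∀ u r → Lift (c ⊔ ℓ) (a ≈ₚ (u *ₚ r)) → Admissible r

  Sat-KM-formula : ∀ a →
    SatA (KM-formula n) (a ∷ᵥ gens) ⇔ (Lift (c ⊔ ℓ) (a ≈ₚ 0ₚ) ⊎ RightFactorsAdmissible a)
  Sat-KM-formula a = mk⇔
    (Sum.map₂ λ adm u r a≈ur → Sum.map₂ (Equivalence.to   (Sat-inGeneratorIdeal 𝔸 (3 ↑ʳ_) (# 0))) (adm u r a≈ur))
    (Sum.map₂ λ adm u r a≈ur → Sum.map₂ (Equivalence.from (Sat-inGeneratorIdeal 𝔸 (3 ↑ʳ_) (# 0))) (adm u r a≈ur))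

  RightFactorsAdmissible-generator : ∀ {a} i d → a ≈ₚ (x i *ₚ d) →
                                     RightFactorsAdmissible a → RightFactorsAdmissible d
  RightFactorsAdmissible-generator {a} i d a≈xd adm u r (lift d≈ur) = adm (x i *ₚ u) r (lift (begin
    a                  ≈⟨ a≈xd ⟩
    x i *ₚ d           ≈⟨ *ₚ-cong (x i) (x i) d (u *ₚ r) (≈ₚ.refl {x i}) d≈ur ⟩
    x i *ₚ (u *ₚ r)    ≈⟨ *ₚ-assoc (x i) u r ⟨
    (x i *ₚ u) *ₚ r    ∎))
    where open ≈ₚ-Reasoning

module Classical {c ℓ} (K : Field c ℓ) (n : ℕ) (em : ExcludedMiddle (c ⊔ ℓ)) where
  open FreeAlgebra K n
  open FreeAlgebraProperties K n
  open FieldProperties K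
  open Field K renaming (Carrier to F; refl to ≈-refl; sym to ≈-sym; trans to ≈-trans)
  open import Data.List.Extrema ℕP.≤-totalOrder
    using (argmax; argmin; argmax-all; argmin-all; f[xs]≤f[argmax]; f[argmin]≤f[xs])

  dec : {P : Set ℓ} → Dec P
  dec {P} = map′ lower lift (em {Lift c P})

  ≈0-stable : ∀ {x} → ¬ ¬ x ≈ 0# → x ≈ 0#
  ≈0-stable = decidable-stable dec

  ⋆-nonzero : ∀ f g w → ¬ (f ⋆ g) w ≈ 0# →
              Σ (Word n) λ v → Σ (Word n) λ t → v ++ t ≡ w × ¬ f v ≈ 0# × ¬ g t ≈ 0#
  ⋆-nonzero f g w fgw≉0 = decidable-stable dec λ ∄split → fgw≉0 (⋆-vanishing f g w (product≈0 ∄split))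
    where
    product≈0 : ¬ (Σ (Word n) λ v → Σ (Word n) λ t → v ++ t ≡ w × ¬ f v ≈ 0# × ¬ g t ≈ 0#) →
                ∀ v t → v ++ t ≡ w → f v * g t ≈ 0#
    product≈0 ∄split v t vt≡w with dec {f v ≈ 0#} | dec {g t ≈ 0#}
    ... | yes fv≈0 | _        = ≈-trans (*-cong fv≈0 ≈-refl) (zeroˡ _)
    ... | no _     | yes gt≈0 = ≈-trans (*-cong ≈-refl gt≈0) (zeroʳ _)
    ... | no fv≉0  | no gt≉0  = ⊥-elim (∄split (v , t , vt≡w , fv≉0 , gt≉0))

  support : Poly → List (Word n)
  support p = filter (λ v → ¬? (dec {coeff p v ≈ 0#})) (map proj₂ p)

  ∈-support : ∀ p {v} → ¬ coeff p v ≈ 0# → v ∈ support p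
  ∈-support p pv≉0 = ∈-filter⁺ (λ v → ¬? (dec {coeff p v ≈ 0#})) (∈-words p pv≉0) pv≉0

  record IsLongest (p : Poly) (v : Word n) : Set ℓ where
    constructor isLongest
    field
      nonzero : ¬ coeff p v ≈ 0#
      maximal : ∀ v′ → ¬ coeff p v′ ≈ 0# → length v′ ≤ length v

  record IsShortest (p : Poly) (v : Word n) : Set ℓ where
    constructor isShortest
    field
      nonzero : ¬ coeff p v ≈ 0#
      minimal : ∀ v′ → ¬ coeff p v′ ≈ 0# → length v ≤ length v′

  longest : ∀ p {v₀} → ¬ coeff p v₀ ≈ 0# → Σ (Word n) (IsLongest p)
  longest p {v₀} pv₀≉0 =
    argmax length v₀ (support p) , isLongest
      (argmax-all length pv₀≉0 (all-filter (λ v → ¬? (dec {coeff p v ≈ 0#})) (map proj₂ p)))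
      (λ v pv≉0 → All.lookup (f[xs]≤f[argmax] v₀ (support p)) (∈-support p pv≉0))

  shortest : ∀ p {v₀} → ¬ coeff p v₀ ≈ 0# → Σ (Word n) (IsShortest p)
  shortest p {v₀} pv₀≉0 =
    argmin length v₀ (support p) , isShortest
      (argmin-all length pv₀≉0 (all-filter (λ v → ¬? (dec {coeff p v ≈ 0#})) (map proj₂ p)))
      (λ v pv≉0 → All.lookup (f[argmin]≤f[xs] v₀ (support p)) (∈-support p pv≉0))

  longer-than-longest : ∀ {p v v′} → IsLongest p v → length v < length v′ → coeff p v′ ≈ 0#
  longer-than-longest (isLongest _ max) |v|<|v′| = ≈0-stable λ pv′≉0 → ℕP.<⇒≱ |v|<|v′| (max _ pv′≉0)

  shorter-than-shortest : ∀ {p v v′} → IsShortest p v → length v′ < length v → coeff p v′ ≈ 0#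
  shorter-than-shortest (isShortest _ min) |v′|<|v| = ≈0-stable λ pv′≉0 → ℕP.<⇒≱ |v′|<|v| (min _ pv′≉0)

  single-support : ∀ p v → (∀ v′ → ¬ coeff p v′ ≈ 0# → v′ ≡ v) → p ≈ₚ mono (coeff p v) v
  single-support p v only w with v ≟ʷ w
  ... | yes refl = ≈-sym (+-identityʳ _)
  ... | no v≢w   = ≈0-stable λ pw≉0 → v≢w (≡.sym (only w pw≉0))

  uniform-length-term : ∀ {p v v′} → IsLongest p v → IsShortest p v′ → length v′ ≡ length v →
                        (∀ v″ → IsLongest p v″ → v″ ≡ v) → p ∈K× v
  uniform-length-term {p} {v} (isLongest pv≉0 max) (isShortest _ min) |v′|≡|v| unique =
    term (coeff p v) pv≉0 (single-support p v λ v″ pv″≉0 →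
      unique v″ (isLongest pv″≉0 λ u pu≉0 →
        ℕP.≤-trans (max u pu≉0) (ℕP.≤-trans (ℕP.≤-reflexive (≡.sym |v′|≡|v|)) (min v″ pv″≉0))))

  module _ {u r α w} (α≉0 : ¬ α ≈ 0#) (ur≈αw : (u *ₚ r) ≈ₚ mono α w) where

    private
      ⋆-nonzero-at-w : ¬ (coeff u ⋆ coeff r) w ≈ 0#
      ⋆-nonzero-at-w ⋆≈0 = α≉0 (≈-trans (≈-sym (coeff-mono-≡ α w))
                                 (≈-trans (≈-sym (ur≈αw w)) (≈-trans (coeff-*ₚ u r w) ⋆≈0)))

      product-word : ∀ {v t} → ¬ coeff u v ≈ 0# → ¬ coeff r t ≈ 0# →
                     (∀ v′ t′ → v′ ++ t′ ≡ v ++ t → length v′ ≢ length v → coeff u v′ * coeff r t′ ≈ 0#) →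
                     v ++ t ≡ w
      product-word {v} {t} uv≉0 rt≉0 others with w ≟ʷ (v ++ t)
      ... | yes w≡vt = ≡.sym w≡vt
      ... | no w≢vt  = ⊥-elim (*-nonzero uv≉0 rt≉0 (begin
        coeff u v * coeff r t          ≈⟨ ⋆-single (coeff u) (coeff r) v t others ⟨
        (coeff u ⋆ coeff r) (v ++ t)   ≈⟨ coeff-*ₚ u r (v ++ t) ⟨
        coeff (u *ₚ r) (v ++ t)        ≈⟨ ur≈αw (v ++ t) ⟩
        coeff (mono α w) (v ++ t)      ≈⟨ coeff-mono-≢ w≢vt ⟩
        0#                             ∎))
        where open ≈-Reasoning

    longest-++-longest : ∀ {v t} → IsLongest u v → IsLongest r t → v ++ t ≡ w
    longest-++-longest {v} {t} uv rt = product-word (IsLongest.nonzero uv) (IsLongest.nonzero rt) others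
      where
      others : ∀ v′ t′ → v′ ++ t′ ≡ v ++ t → length v′ ≢ length v → coeff u v′ * coeff r t′ ≈ 0#
      others v′ t′ v′t′≡vt |v′|≢|v| with ℕP.<-cmp (length v′) (length v)
      ... | tri< |v′|<|v| _ _ =
        ≈-trans (*-cong ≈-refl (longer-than-longest rt (length-split-< v t v′ t′ v′t′≡vt |v′|<|v|))) (zeroʳ _)
      ... | tri≈ _ |v′|≡|v| _ = ⊥-elim (|v′|≢|v| |v′|≡|v|)
      ... | tri> _ _ |v|<|v′| = ≈-trans (*-cong (longer-than-longest uv |v|<|v′|) ≈-refl) (zeroˡ _)

    shortest-++-shortest : ∀ {v t} → IsShortest u v → IsShortest r t → v ++ t ≡ w
    shortest-++-shortest {v} {t} uv rt = product-word (IsShortest.nonzero uv) (IsShortest.nonzero rt) others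
      where
      others : ∀ v′ t′ → v′ ++ t′ ≡ v ++ t → length v′ ≢ length v → coeff u v′ * coeff r t′ ≈ 0#
      others v′ t′ v′t′≡vt |v′|≢|v| with ℕP.<-cmp (length v′) (length v)
      ... | tri< |v′|<|v| _ _ = ≈-trans (*-cong (shorter-than-shortest uv |v′|<|v|) ≈-refl) (zeroˡ _)
      ... | tri≈ _ |v′|≡|v| _ = ⊥-elim (|v′|≢|v| |v′|≡|v|)
      ... | tri> _ _ |v|<|v′| =
        ≈-trans (*-cong ≈-refl (shorter-than-shortest rt (length-split-< v′ t′ v t (≡.sym v′t′≡vt) |v|<|v′|))) (zeroʳ _)

    -- Longest words multiply to w, and so do shortest words; comparing lengths shows that all
    -- words in the support of u (resp. r) have the same length, and the longest one is unique.
    factors-of-term : Σ (Word n) λ v → Σ (Word n) λ t → v ++ t ≡ w × u ∈K× v × r ∈K× t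
    factors-of-term with ⋆-nonzero (coeff u) (coeff r) w ⋆-nonzero-at-w
    ... | v₀ , t₀ , _ , uv₀≉0 , rt₀≉0
      with longest u uv₀≉0 | shortest u uv₀≉0 | longest r rt₀≉0 | shortest r rt₀≉0
    ... | v , uv | v′ , uv′ | t , rt | t′ , rt′ =
      v , t , vt≡w ,
      uniform-length-term uv uv′ |v′|≡|v|
        (λ v″ uv″ → ListP.++-cancelʳ t v″ v (≡.trans (longest-++-longest uv″ rt) (≡.sym vt≡w))) ,
      uniform-length-term rt rt′ |t′|≡|t|
        (λ t″ rt″ → ListP.++-cancelˡ v t″ t (≡.trans (longest-++-longest uv rt″) (≡.sym vt≡w)))
      where
      vt≡w : v ++ t ≡ w
      vt≡w = longest-++-longest uv rt
      lengths : length v′ ℕ.+ length t′ ≡ length v ℕ.+ length t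
      lengths = length-++-≡ v t v′ t′ (≡.trans (shortest-++-shortest uv′ rt′) (≡.sym vt≡w))
      |v′|≡|v| : length v′ ≡ length v
      |v′|≡|v| = ≤-+-≡⇒≡ˡ (IsLongest.maximal uv v′ (IsShortest.nonzero uv′))
                          (IsLongest.maximal rt t′ (IsShortest.nonzero rt′)) lengths
      |t′|≡|t| : length t′ ≡ length t
      |t′|≡|t| = ℕP.+-cancelˡ-≡ (length v) _ _ (≡.trans (≡.cong (ℕ._+ length t′) (≡.sym |v′|≡|v|)) lengths)

  unit⇒scalar : ∀ {p} → IsUnit p → p ∈K× []
  unit⇒scalar {p} (s , lift ps≈1) with factors-of-term {u = p} {r = s} {w = []} 1≉0 ps≈1
  ... | [] , _ , _   , p∈K×[] , _ = p∈K×[]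
  ... | _ ∷ _ , _ , () , _ , _

  unit⇔ : ∀ {p w} → p ∈K× w → IsUnit p ⇔ w ≡ []
  unit⇔ p∈w = mk⇔ (∈K×-word-unique p∈w ∘ unit⇒scalar) λ { refl → scalar⇒unit p∈w }

  associated⇔ : ∀ {p q v w} → p ∈K× v → q ∈K× w → Associated p q ⇔ v ≡ w
  associated⇔ {p} {q} p∈v q∈w = mk⇔
    (λ (t , t-unit , lift p≈tq) →
       ∈K×-word-unique p∈v (∈K×-resp-≈ₚ p≈tq (*ₚ-∈K× (unit⇒scalar {t} t-unit) q∈w)))
    (λ { refl → sameWord⇒associated p∈v q∈w })

  InKM⇔ : ∀ a → InKM a ⇔ (Lift (c ⊔ ℓ) (a ≈ₚ 0ₚ) ⊎ Σ (Word n) (a ∈K×_))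
  InKM⇔ a = mk⇔ to from
    where
    to : InKM a → Lift (c ⊔ ℓ) (a ≈ₚ 0ₚ) ⊎ Σ (Word n) (a ∈K×_)
    to (α , w , a≈αw) with dec {α ≈ 0#}
    ... | yes α≈0 = inj₁ (lift λ v → ≈-trans (a≈αw v) (mono-≈0 w α≈0 v))
    ... | no α≉0  = inj₂ (w , term α α≉0 a≈αw)
    from : Lift (c ⊔ ℓ) (a ≈ₚ 0ₚ) ⊎ Σ (Word n) (a ∈K×_) → InKM a
    from (inj₁ (lift a≈0))              = 0# , [] , λ v → ≈-trans (a≈0 v) (≈-sym (mono-≈0 [] ≈-refl v))
    from (inj₂ (w , term α _ a≈αw)) = α , w , a≈αw

  term⇒RightFactorsAdmissible : ∀ {a w} → a ∈K× w → RightFactorsAdmissible a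
  term⇒RightFactorsAdmissible {w = w} (term α α≉0 a≈αw) u r (lift a≈ur)
    with factors-of-term {u = u} {r = r} {w = w} α≉0 (λ v → ≈-trans (≈-sym (a≈ur v)) (a≈αw v))
  ... | _ , []    , _ , _ , r∈K×[]          = inj₁ (inj₂ (scalar⇒unit r∈K×[]))
  ... | _ , i ∷ t , _ , _ , term γ _ r≈γit = inj₂ (i , mono γ t , lift (begin
    r                          ≈⟨ r≈γit ⟩
    mono γ (i ∷ t)             ≈⟨ mono-cong (i ∷ t) (*-identityˡ γ) ⟨
    mono 1# [ i ] *ₚ mono γ t  ≡⟨ ≡.cong (_*ₚ mono γ t) (x≡mono i) ⟨
    x i *ₚ mono γ t            ∎))
    where open ≈ₚ-Reasoning

  Bounded-zero : ∀ {a} → Bounded 0 a → a ≈ₚ 0ₚ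
  Bounded-zero a<0 w = ≈0-stable λ aw≉0 → ℕP.n≮0 (a<0 w aw≉0)

  RightFactorsAdmissible⇒InKM : ∀ N a → Bounded N a → RightFactorsAdmissible a → InKM a
  RightFactorsAdmissible⇒InKM zero a a<0 _ = Equivalence.from (InKM⇔ a) (inj₁ (lift (Bounded-zero {a} a<0)))
  RightFactorsAdmissible⇒InKM (suc N) a a<N adm with adm 1ₚ a (lift (≈ₚ.sym {1ₚ *ₚ a} {a} (*ₚ-identityˡ a)))
  ... | inj₁ (inj₁ a≈0)  = Equivalence.from (InKM⇔ a) (inj₁ a≈0)
  ... | inj₁ (inj₂ unit) = Equivalence.from (InKM⇔ a) (inj₂ ([] , unit⇒scalar unit))
  ... | inj₂ (i , d , lift a≈xd)
    with RightFactorsAdmissible⇒InKM N d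
           (Bounded-generator-*ₚ i d
             (Bounded-resp-≈ₚ {p = x i *ₚ d} {q = a} (≈ₚ.sym {a} {x i *ₚ d} a≈xd) a<N))
           (RightFactorsAdmissible-generator {a} i d a≈xd adm)
  ... | β , v , d≈βv = β , i ∷ v , (begin
    a                      ≈⟨ a≈xd ⟩
    x i *ₚ d               ≈⟨ *ₚ-cong (x i) (x i) d (mono β v) (≈ₚ.refl {x i}) d≈βv ⟩
    x i *ₚ mono β v        ≡⟨ ≡.cong (_*ₚ mono β v) (x≡mono i) ⟩
    mono (1# * β) (i ∷ v)  ≈⟨ mono-cong (i ∷ v) (*-identityˡ β) ⟩
    mono β (i ∷ v)         ∎)
    where open ≈ₚ-Reasoning

  KM-formula-defines : DefinesKM K n (KM-formula n)
  KM-formula-defines a = mk⇔ to from ⇔-∘ Sat-KM-formula a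
    where
    to : Lift (c ⊔ ℓ) (a ≈ₚ 0ₚ) ⊎ RightFactorsAdmissible a → InKM a
    to (inj₁ a≈0) = Equivalence.from (InKM⇔ a) (inj₁ a≈0)
    to (inj₂ adm) = RightFactorsAdmissible⇒InKM (proj₁ (bounded a)) a (proj₂ (bounded a)) adm
    from : InKM a → Lift (c ⊔ ℓ) (a ≈ₚ 0ₚ) ⊎ RightFactorsAdmissible a
    from = Sum.map₂ (term⇒RightFactorsAdmissible ∘ proj₂) ∘ Equivalence.to (InKM⇔ a)

  open MonoidInterpretation (freeMonoidInterpretation n)

  domain⇔term : ∀ p → SatA δ (p ∷ᵥ gens) ⇔ Σ (Word n) (p ∈K×_)
  domain⇔term p = mk⇔ to from
    where
    to : SatA δ (p ∷ᵥ gens) → Σ (Word n) (p ∈K×_)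
    to (sat , p≉0) with Equivalence.to (InKM⇔ p) (Equivalence.to (KM-formula-defines p) sat)
    ... | inj₁ p≈0 = ⊥-elim (p≉0 p≈0)
    ... | inj₂ p∈w = p∈w
    from : Σ (Word n) (p ∈K×_) → SatA δ (p ∷ᵥ gens)
    from (w , p∈w@(term α _ p≈αw)) =
      Equivalence.from (KM-formula-defines p) (α , w , p≈αw) , λ (lift p≈0) → ∈K×-nonzero p∈w p≈0

  represents : ∀ {p w} v → p ∈K× w → Associated p (mono 1# v) ⇔ w ≡ v
  represents v p∈w = associated⇔ p∈w (mono-∈K× v 1≉0)

  product-represents : ∀ {p q d w v u} → p ∈K× w → q ∈K× v → d ∈K× u →
    Associated d (p *ₚ q) ⇔ (Σ (Word n) λ w′ → Σ (Word n) λ v′ →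
      Associated p (mono 1# w′) × Associated q (mono 1# v′) × Associated d (mono 1# (w′ ++ v′)))
  product-represents {p} {q} {d} {w} {v} {u} p∈w q∈v d∈u = mk⇔
    (λ d~pq → w , v , Equivalence.from (represents w p∈w) refl , Equivalence.from (represents v q∈v) refl ,
       Equivalence.from (represents (w ++ v) d∈u) (Equivalence.to d~pq⇔ d~pq))
    (λ (w′ , v′ , p~w′ , q~v′ , d~w′v′) → Equivalence.from d~pq⇔ (≡.trans
       (Equivalence.to (represents (w′ ++ v′) d∈u) d~w′v′)
       (≡.sym (≡.cong₂ _++_ (Equivalence.to (represents w′ p∈w) p~w′)
                            (Equivalence.to (represents v′ q∈v) q~v′)))))
    where
    d~pq⇔ : Associated d (p *ₚ q) ⇔ u ≡ w ++ v
    d~pq⇔ = associated⇔ d∈u (*ₚ-∈K× p∈w q∈v)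

  freeMonoid-interpreted : InterpretsFreeMonoid K n 1 (freeMonoidInterpretation n)
  freeMonoid-interpreted = record
    { ε-refl  = λ { (p ∷ᵥ []ᵥ) dp →
                  let _ , p∈w = term-of p dp in Equivalence.from (associated⇔ p∈w p∈w) refl }
    ; ε-sym   = λ { (p ∷ᵥ []ᵥ) (q ∷ᵥ []ᵥ) dp dq p~q →
                  let _ , p∈w = term-of p dp ; _ , q∈v = term-of q dq in
                  Equivalence.from (associated⇔ q∈v p∈w) (≡.sym (Equivalence.to (associated⇔ p∈w q∈v) p~q)) }
    ; ε-trans = λ { (p ∷ᵥ []ᵥ) (q ∷ᵥ []ᵥ) (d ∷ᵥ []ᵥ) dp dq dd p~q q~d →
                  let _ , p∈w = term-of p dp ; _ , q∈v = term-of q dq ; _ , d∈u = term-of d dd in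
                  Equivalence.from (associated⇔ p∈w d∈u)
                    (≡.trans (Equivalence.to (associated⇔ p∈w q∈v) p~q) (Equivalence.to (associated⇔ q∈v d∈u) q~d)) }
    ; f       = λ w → mono 1# w ∷ᵥ []ᵥ
    ; f-dom   = λ w → Equivalence.from (domain⇔term (mono 1# w)) (w , mono-∈K× w 1≉0)
    ; f-inj   = λ w v → Equivalence.to (represents v (mono-∈K× w 1≉0))
    ; f-surj  = λ { (p ∷ᵥ []ᵥ) dp → let w , p∈w = term-of p dp in w , Equivalence.from (represents w p∈w) refl }
    ; μ-spec  = λ { (p ∷ᵥ []ᵥ) (q ∷ᵥ []ᵥ) (d ∷ᵥ []ᵥ) dp dq dd →
                  product-represents (proj₂ (term-of p dp)) (proj₂ (term-of q dq)) (proj₂ (term-of d dd)) }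
    ; ι-spec  = λ { (p ∷ᵥ []ᵥ) dp →
                  let _ , p∈w = term-of p dp in ⇔-sym (represents [] p∈w) ⇔-∘ unit⇔ p∈w }
    }
    where
    term-of : ∀ p → SatA δ (p ∷ᵥ gens) → Σ (Word n) (p ∈K×_)
    term-of p = Equivalence.to (domain⇔term p)

lemma6p4 : (n : ℕ) →
    Σω (Formula (suc n))
    (λ φ → ∀ {c ℓ} (K : Field c ℓ) → ExcludedMiddle (c ⊔ ℓ) → DefinesKM K n φ)
    ×ω
    Σω ℕ (λ k → Σω (MonoidInterpretation n k)
    (λ I → ∀ {c ℓ} (K : Field c ℓ) → ExcludedMiddle (c ⊔ ℓ) → InterpretsFreeMonoid K n k I))
lemma6p4 n =
  (KM-formula n ,ω λ K em → Classical.KM-formula-defines K n em) ,,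
  (1 ,ω (freeMonoidInterpretation n ,ω λ K em → Classical.freeMonoid-interpreted K n em))
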